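{- Let $P$ be an indecomposable pattern without empty rows or columns, and with only one 1-entry in the last row and one 1-entry in the last column. Then $\mathrm{sat}(P,n) \in \mathcal{O}(1)$ if and only if there exist constants $m_0, n_0$ such that $\mathrm{sat}(P,m_0, n) \in \mathcal{O}(1)$ and $\mathrm{sat}(P,m, n_0) \in \mathcal{O}(1)$.
   Context: All matrices are 0-1 matrices; a pattern is a matrix that is not all-zero; a row or column is empty if it contains only 0s. A matrix $M$ contains a pattern $P$ if $P$ can be obtained from $M$ by deleting rows and/or columns and turning arbitrary 1-entries into 0s; otherwise $M$ avoids $P$. A matrix $M$ is $P$-saturating if it avoids $P$ but changing any 0-entry of $M$ into a 1 creates an occurrence of $P$. $\mathrm{sat}(P,m,n)$ is the minimum number of 1-entries in an $m \times n$ $P$-saturating matrix, and $\mathrm{sat}(P,n)=\mathrm{sat}(P,n,n)$. A pattern $P$ is decomposable if it has the form $\begin{pmatrix} A & \mathbf{0} \\ \mathbf{0} & B \end{pmatrix}$ or $\begin{pmatrix} \mathbf{0} & A \\ B & \mathbf{0} \end{pmatrix}$ for two matrices $A, B \neq \mathbf{0}$, where $\mathbf{0}$ denotes an all-0 matrix of the appropriate size; otherwise it is indecomposable. -}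

module Defs where

open import Data.Nat using (ℕ; zero; suc; _+_; _≤_; _<_)
open import Data.Fin using (Fin; toℕ; _≟_)
open import Data.Bool using (Bool; true; false; if_then_else_; _∧_)
open import Data.List using (List; map; allFin)
open import Data.Nat.ListAction using (sum)
open import Data.Product using (Σ; ∃; _×_; _,_)
open import Data.Sum using (_⊎_)
open import Relation.Nullary using (¬_; ⌊_⌋)
open import Relation.Binary.PropositionalEquality using (_≡_)

-- An m × n 0-1 matrix: entry (i , j) is true iff it is a 1-entry.
Matrix : ℕ → ℕ → Set
Matrix m n = Fin m → Fin n → Bool

ones : ∀ {m n} → Matrix m n → ℕ
ones {m} {n} M = sum (map (λ i → sum (map (λ j → if M i j then 1 else 0) (allFin n))) (allFin m))

StrictlyIncreasing : ∀ {k m} → (Fin k → Fin m) → Set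
StrictlyIncreasing f = ∀ i j → toℕ i < toℕ j → toℕ (f i) < toℕ (f j)

-- M contains P: P is obtained from M by deleting rows/columns and turning
-- some 1-entries into 0s, i.e. there are increasing row/column embeddings
-- such that every 1-entry of P lands on a 1-entry of M.
Contains : ∀ {k l m n} → Matrix k l → Matrix m n → Set
Contains {k} {l} {m} {n} P M =
  Σ (Fin k → Fin m) λ r → Σ (Fin l → Fin n) λ c →
    StrictlyIncreasing r × StrictlyIncreasing c ×
    (∀ i j → P i j ≡ true → M (r i) (c j) ≡ true)

Avoids : ∀ {k l m n} → Matrix k l → Matrix m n → Set
Avoids P M = ¬ Contains P M

setOne : ∀ {m n} → Matrix m n → Fin m → Fin n → Matrix m n
setOne M i j i' j' = if ⌊ i' ≟ i ⌋ ∧ ⌊ j' ≟ j ⌋ then true else M i' j'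

Saturating : ∀ {k l m n} → Matrix k l → Matrix m n → Set
Saturating P M =
  Avoids P M × (∀ i j → M i j ≡ false → Contains P (setOne M i j))

-- sat(P,m,n) ≤ c, i.e. (since sat is the minimum of the number of 1-entries
-- over all m × n P-saturating matrices) some m × n P-saturating matrix has
-- at most c 1-entries.
SatLe : ∀ {k l} → Matrix k l → ℕ → ℕ → ℕ → Set
SatLe P m n c = Σ (Matrix m n) λ M → Saturating P M × ones M ≤ c

SatSquareO1 : ∀ {k l} → Matrix k l → Set
SatSquareO1 P = ∃ λ C → ∃ λ N → ∀ n → N ≤ n → SatLe P n n C

SatRowsO1 : ∀ {k l} → Matrix k l → ℕ → Set
SatRowsO1 P m₀ = ∃ λ C → ∃ λ N → ∀ n → N ≤ n → SatLe P m₀ n C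

SatColsO1 : ∀ {k l} → Matrix k l → ℕ → Set
SatColsO1 P n₀ = ∃ λ C → ∃ λ N → ∀ m → N ≤ m → SatLe P m n₀ C

EmptyRow : ∀ {k l} → Matrix k l → Fin k → Set
EmptyRow P i = ∀ j → P i j ≡ false

EmptyCol : ∀ {k l} → Matrix k l → Fin l → Set
EmptyCol P j = ∀ i → P i j ≡ false

NoEmptyRowsCols : ∀ {k l} → Matrix k l → Set
NoEmptyRowsCols P = (∀ i → ¬ EmptyRow P i) × (∀ j → ¬ EmptyCol P j)

-- Decomposable: rows split at r (first r rows / rest), columns split at c.
-- Form [[A,0],[0,B]]: every 1-entry lies in the top-left or bottom-right
-- block, and both blocks contain a 1 (A, B ≠ 0).
-- Form [[0,A],[B,0]]: every 1-entry lies in the top-right or bottom-left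
-- block, and both blocks contain a 1.
DiagForm : ∀ {k l} → Matrix k l → ℕ → ℕ → Set
DiagForm P r c =
  (∀ i j → P i j ≡ true →
     (toℕ i < r × toℕ j < c) ⊎ (r ≤ toℕ i × c ≤ toℕ j)) ×
  (∃ λ i → ∃ λ j → P i j ≡ true × toℕ i < r × toℕ j < c) ×
  (∃ λ i → ∃ λ j → P i j ≡ true × r ≤ toℕ i × c ≤ toℕ j)

AntiDiagForm : ∀ {k l} → Matrix k l → ℕ → ℕ → Set
AntiDiagForm P r c =
  (∀ i j → P i j ≡ true →
     (toℕ i < r × c ≤ toℕ j) ⊎ (r ≤ toℕ i × toℕ j < c)) ×
  (∃ λ i → ∃ λ j → P i j ≡ true × toℕ i < r × c ≤ toℕ j) ×
  (∃ λ i → ∃ λ j → P i j ≡ true × r ≤ toℕ i × toℕ j < c)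

Decomposable : ∀ {k l} → Matrix k l → Set
Decomposable P = ∃ λ r → ∃ λ c → DiagForm P r c ⊎ AntiDiagForm P r c

Indecomposable : ∀ {k l} → Matrix k l → Set
Indecomposable P = ¬ Decomposable P

OneInRow : ∀ {k l} → Matrix k l → Fin k → Set
OneInRow P i = ∃ λ j → P i j ≡ true × (∀ j' → P i j' ≡ true → j' ≡ j)

OneInCol : ∀ {k l} → Matrix k l → Fin l → Set
OneInCol P j = ∃ λ i → P i j ≡ true × (∀ i' → P i' j ≡ true → i' ≡ i)

-- If sat(P, n) ≤ c for all large n, an n × n P-saturating matrix with at most c 1-entries
-- has empty rows; since P has no empty rows, deleting them keeps the matrix P-saturating,
-- which leaves (c + 1) × n matrices, and likewise for columns. Conversely, take P-saturating
-- matrices A with m₀ rows and B with n₀ columns having so few 1-entries that A has an empty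
-- column and B an empty row. The block matrix (0 A / B 0) avoids P because P is
-- indecomposable; extend it to a P-saturating matrix. The empty row of B and the empty column
-- of A stay empty: inside the blocks each of their entries is blocked by the saturation of A
-- or B, and in the zero blocks because the single 1 of the last row (column) of P can be moved
-- from the last row of A (last column of B) further down (right). Finally, duplicating an
-- empty row or column preserves saturation and the number of 1-entries, giving n × n
-- P-saturating matrices with a bounded number of 1-entries for every large n.

module Submission where

open import Defs
open import Data.Nat using (ℕ; suc)
open import Data.Fin using (fromℕ)
open import Data.Product using (∃; _×_)
open import Function.Bundles using (_⇔_)

open import Data.Nat using (zero; _+_; _∸_; _≤_; _<_; z≤n; s≤s; s≤s⁻¹; _<?_; _≤?_)
open import Data.Nat.Properties
open import Data.Fin as Fin using (Fin; toℕ; _↑ˡ_; _↑ʳ_; splitAt; punchIn; pinch)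
open import Data.Fin.Properties as Finₚ using (toℕ-injective; any?; all?; ¬∀⟶∃¬)
open import Data.Bool using (Bool; true; false; if_then_else_; _∧_)
open import Data.Bool.Properties as Boolₚ using (¬-not; ∧-comm)
open import Data.List using (List; []; _∷_; map; allFin; cartesianProduct; tabulate)
open import Data.List.Properties using (map-tabulate)
open import Data.List.Relation.Unary.All as All using (All; []; _∷_)
open import Data.List.Membership.Propositional.Properties using (∈-cartesianProduct⁺; ∈-allFin)
import Data.Nat.ListAction as List
open import Algebra.Properties.CommutativeMonoid.Sum +-0-commutativeMonoid
  using (sum; sum-syntax; sum-cong-≗; sum-remove; sum-replicate-zero; ∑-comm)
open import Algebra.Properties.CommutativeSemigroup +-commutativeSemigroup using (x∙yz≈y∙xz)
open import Data.Product using (Σ-syntax; _,_; proj₁; proj₂)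
open import Data.Sum using (_⊎_; inj₁; inj₂)
open import Relation.Nullary using (¬_; ⌊_⌋; Dec; yes; no; contradiction)
open import Relation.Nullary.Decidable using (_×-dec_; _⊎-dec_; _→-dec_)
open import Relation.Binary.Definitions using (Monotonic₁)
open import Relation.Binary.PropositionalEquality
open import Function using (_∘_; id)
import Data.Vec.Functional as Vector
open import Data.Vec.Functional.Properties using (∷-cong)
open import Function.Bundles using (mk⇔; Equivalence)

private variable
  k l m n m' n' : ℕ

Tr : Matrix m n → Matrix n m
Tr M j i = M i j

_⊆_ : Matrix m n → Matrix m n → Set
M ⊆ M' = ∀ i j → M i j ≡ true → M' i j ≡ true

setOne-here : (M : Matrix m n) → ∀ i j → setOne M i j i j ≡ true
setOne-here M i j with i Fin.≟ i | j Fin.≟ j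
... | yes _  | yes _  = refl
... | no i≢i | _      = contradiction refl i≢i
... | yes _  | no j≢j = contradiction refl j≢j

M⊆setOne : (M : Matrix m n) → ∀ i j → M ⊆ setOne M i j
M⊆setOne M i j i' j' M≡true with ⌊ i' Fin.≟ i ⌋ ∧ ⌊ j' Fin.≟ j ⌋
... | true  = refl
... | false = M≡true

setOne-true : (M : Matrix m n) → ∀ i j i' j' → setOne M i j i' j' ≡ true →
  (i' ≡ i × j' ≡ j) ⊎ M i' j' ≡ true
setOne-true M i j i' j' eq with i' Fin.≟ i | j' Fin.≟ j
... | yes i'≡i | yes j'≡j = inj₁ (i'≡i , j'≡j)
... | yes _    | no _     = inj₂ eq
... | no _     | _        = inj₂ eq

setOne-⊆ : {M M' : Matrix m n} → ∀ i j → M ⊆ M' → setOne M i j ⊆ setOne M' i j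
setOne-⊆ {M = M} {M'} i j M⊆M' i' j' eq with setOne-true M i j i' j' eq
... | inj₁ (refl , refl) = setOne-here M' i j
... | inj₂ M≡true        = M⊆setOne M' i j i' j' (M⊆M' i' j' M≡true)

setOne-⊆-self : (M : Matrix m n) → ∀ i j → M i j ≡ true → setOne M i j ⊆ M
setOne-⊆-self M i j Mij≡true i' j' eq with setOne-true M i j i' j' eq
... | inj₁ (refl , refl) = Mij≡true
... | inj₂ M≡true        = M≡true

setOne-transpose : (M : Matrix m n) → ∀ i j → Tr (setOne M i j) ⊆ setOne (Tr M) j i
setOne-transpose M i j j' i' =
  subst (_≡ true) (cong (if_then true else M i' j') (∧-comm ⌊ i' Fin.≟ i ⌋ ⌊ j' Fin.≟ j ⌋))

StrictlyIncreasing⇒monotone : {f : Fin m → Fin n} → StrictlyIncreasing f →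
  Monotonic₁ Fin._≤_ Fin._≤_ f
StrictlyIncreasing⇒monotone {f = f} f-inc {i} {j} i≤j with m≤n⇒m<n∨m≡n i≤j
... | inj₁ i<j = <⇒≤ (f-inc i j i<j)
... | inj₂ i≡j = ≤-reflexive (cong (toℕ ∘ f) (toℕ-injective i≡j))

monotone-reflects-< : {f : Fin m → Fin n} → Monotonic₁ Fin._≤_ Fin._≤_ f →
  ∀ {i j} → f i Fin.< f j → i Fin.< j
monotone-reflects-< f-mono fi<fj = ≰⇒> λ j≤i → <⇒≱ fi<fj (f-mono j≤i)

StrictlyIncreasing⇒injective : {f : Fin m → Fin n} → StrictlyIncreasing f →
  ∀ {i j} → f i ≡ f j → i ≡ j
StrictlyIncreasing⇒injective f-inc {i} {j} fi≡fj = toℕ-injective (≤-antisym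
  (≮⇒≥ λ j<i → <⇒≢ (f-inc _ _ j<i) (sym (cong toℕ fi≡fj)))
  (≮⇒≥ λ i<j → <⇒≢ (f-inc _ _ i<j) (cong toℕ fi≡fj)))

StrictlyIncreasing⇒⌊≟⌋ : {f : Fin m → Fin n} → StrictlyIncreasing f →
  ∀ a b → ⌊ f a Fin.≟ f b ⌋ ≡ ⌊ a Fin.≟ b ⌋
StrictlyIncreasing⇒⌊≟⌋ {f = f} f-inc a b with a Fin.≟ b | f a Fin.≟ f b
... | yes _    | yes _     = refl
... | no _     | no _      = refl
... | yes refl | no fa≢fa  = contradiction refl fa≢fa
... | no a≢b   | yes fa≡fb = contradiction (StrictlyIncreasing⇒injective f-inc fa≡fb) a≢b

StrictlyIncreasing-cancelˡ : {g : Fin n → Fin m} {f : Fin k → Fin n} {h : Fin k → Fin m} →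
  Monotonic₁ Fin._≤_ Fin._≤_ g → (∀ x → g (f x) ≡ h x) → StrictlyIncreasing h → StrictlyIncreasing f
StrictlyIncreasing-cancelˡ g-mono gf≗h h-inc x y x<y =
  monotone-reflects-< g-mono (subst₂ Fin._<_ (sym (gf≗h x)) (sym (gf≗h y)) (h-inc x y x<y))

StrictlyIncreasing-≢fromℕ : {f : Fin (suc k) → Fin (suc m)} → StrictlyIncreasing f →
  ∀ {i} → i ≢ fromℕ k → f i ≢ fromℕ m
StrictlyIncreasing-≢fromℕ {k} {f = f} f-inc {i} i≢last fi≡last = <⇒≱
  (f-inc i (fromℕ k) (Finₚ.≤∧≢⇒< (Finₚ.≤fromℕ i) i≢last))
  (subst (f (fromℕ k) Fin.≤_) (sym fi≡last) (Finₚ.≤fromℕ (f (fromℕ k))))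

StrictlyIncreasing-∘ : {f : Fin n → Fin m} {g : Fin k → Fin n} →
  StrictlyIncreasing f → StrictlyIncreasing g → StrictlyIncreasing (f ∘ g)
StrictlyIncreasing-∘ f-inc g-inc i j i<j = f-inc _ _ (g-inc i j i<j)

EveryRowHasOne : Matrix k l → Set
EveryRowHasOne P = ∀ i → ∃ λ j → P i j ≡ true

¬EmptyRow⇒hasOne : (P : Matrix k l) → (∀ i → ¬ EmptyRow P i) → EveryRowHasOne P
¬EmptyRow⇒hasOne {l = l} P nonEmpty i =
  let j , Pij≢false = ¬∀⟶∃¬ l (λ j → P i j ≡ false) (λ j → P i j Boolₚ.≟ false) (nonEmpty i)
  in j , ¬-not Pij≢false

Contains-⊆ : {P : Matrix k l} {M M' : Matrix m n} → M ⊆ M' → Contains P M → Contains P M'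
Contains-⊆ M⊆M' (R , C , R-inc , C-inc , hit) = R , C , R-inc , C-inc , λ i j p → M⊆M' _ _ (hit i j p)

Contains-transpose : {P : Matrix k l} {M : Matrix m n} → Contains P M → Contains (Tr P) (Tr M)
Contains-transpose (R , C , R-inc , C-inc , hit) = C , R , C-inc , R-inc , λ j i p → hit i j p

Saturating-transpose : {P : Matrix k l} {M : Matrix m n} → Saturating P M → Saturating (Tr P) (Tr M)
Saturating-transpose {P = P} {M = M} (avoids , saturates) =
  (λ occ → avoids (Contains-transpose {P = Tr P} {M = Tr M} occ)) ,
  λ j i Mij≡false → Contains-⊆ (setOne-transpose M i j)
                      (Contains-transpose {P = P} {M = setOne M i j} (saturates i j Mij≡false))

record Submatrix (A : Matrix m n) (M : Matrix m' n') : Set where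
  field
    row : Fin m → Fin m'
    col : Fin n → Fin n'
    row-inc : StrictlyIncreasing row
    col-inc : StrictlyIncreasing col
    entry : ∀ x y → M (row x) (col y) ≡ A x y

module _ {A : Matrix m n} {M : Matrix m' n'} (S : Submatrix A M) where
  open Submatrix S

  Submatrix-transpose : Submatrix (Tr A) (Tr M)
  Submatrix-transpose = record
    { row = col ; col = row ; row-inc = col-inc ; col-inc = row-inc ; entry = λ y x → entry x y }

  Contains-submatrix : {P : Matrix k l} → Contains P A → Contains P M
  Contains-submatrix (R , C , R-inc , C-inc , hit) =
    row ∘ R , col ∘ C , StrictlyIncreasing-∘ row-inc R-inc , StrictlyIncreasing-∘ col-inc C-inc ,
    λ i j p → trans (entry (R i) (C j)) (hit i j p)

  Submatrix-setOne : ∀ x y → Submatrix (setOne A x y) (setOne M (row x) (col y))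
  Submatrix-setOne x y = record
    { row = row ; col = col ; row-inc = row-inc ; col-inc = col-inc ; entry = entry′ }
    where
    entry′ : ∀ x' y' → setOne M (row x) (col y) (row x') (col y') ≡ setOne A x y x' y'
    entry′ x' y'
      rewrite StrictlyIncreasing⇒⌊≟⌋ row-inc x' x | StrictlyIncreasing⇒⌊≟⌋ col-inc y' y | entry x' y' = refl

  Contains-restrict : {P : Matrix k l} (R : Fin k → Fin m') (C : Fin l → Fin n') →
    StrictlyIncreasing R → StrictlyIncreasing C → (∀ i j → P i j ≡ true → M (R i) (C j) ≡ true) →
    (∀ i → ∃ λ x → row x ≡ R i) → (∀ j → ∃ λ y → col y ≡ C j) → Contains P A
  Contains-restrict R C R-inc C-inc hit R-in C-in = proj₁ ∘ R-in , proj₁ ∘ C-in ,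
    StrictlyIncreasing-cancelˡ (StrictlyIncreasing⇒monotone row-inc) (proj₂ ∘ R-in) R-inc ,
    StrictlyIncreasing-cancelˡ (StrictlyIncreasing⇒monotone col-inc) (proj₂ ∘ C-in) C-inc ,
    λ i j Pij≡true → trans (sym (entry _ _))
      (subst₂ (λ r c → M r c ≡ true) (sym (proj₂ (R-in i))) (sym (proj₂ (C-in j))) (hit i j Pij≡true))

rowCount : Matrix m n → Fin m → ℕ
rowCount {n = n} M i = ∑[ j < n ] (if M i j then 1 else 0)

ones≡∑rowCount : (M : Matrix m n) → ones M ≡ ∑[ i < m ] rowCount M i
ones≡∑rowCount {m} {n} M = sum-allFin {m} λ i → sum-allFin {n} λ j → refl
  where
  sum-tabulate : ∀ {k} {g f : Fin k → ℕ} → (∀ i → g i ≡ f i) → List.sum (tabulate g) ≡ sum f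
  sum-tabulate {zero}  g≗f = refl
  sum-tabulate {suc k} g≗f = cong₂ _+_ (g≗f Fin.zero) (sum-tabulate (g≗f ∘ Fin.suc))
  sum-allFin : ∀ {k} {g f : Fin k → ℕ} → (∀ i → g i ≡ f i) → List.sum (map g (allFin k)) ≡ sum f
  sum-allFin {g = g} g≗f = trans (cong List.sum (map-tabulate id g)) (sum-tabulate g≗f)

∑-pinch : (t : Fin n → ℕ) (z : Fin n) → sum (t ∘ pinch z) ≡ t z + sum t
∑-pinch {suc n} t Fin.zero    = refl
∑-pinch {suc n} t (Fin.suc z) =
  trans (cong (t Fin.zero +_) (∑-pinch (t ∘ Fin.suc) z)) (x∙yz≈y∙xz (t Fin.zero) (t (Fin.suc z)) _)

term≤∑ : (t : Fin n → ℕ) (i : Fin n) → t i ≤ sum t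
term≤∑ {suc n} t i = ≤-trans (m≤m+n (t i) _) (≤-reflexive (sym (sum-remove {i = i} t)))

∑<n⇒zero : (t : Fin n → ℕ) → sum t < n → ∃ λ i → t i ≡ 0
∑<n⇒zero {suc n} t ∑t<n with t Fin.zero in t₀≡
... | zero  = Fin.zero , t₀≡
... | suc _ = let i , tᵢ≡0 = ∑<n⇒zero (t ∘ Fin.suc) (≤-trans (s≤s (m≤n+m _ _)) (s≤s⁻¹ ∑t<n))
              in Fin.suc i , tᵢ≡0

rowCount-empty : (M : Matrix m n) → ∀ z → EmptyRow M z → rowCount M z ≡ 0
rowCount-empty {n = n} M z empty =
  trans (sum-cong-≗ λ j → cong (if_then 1 else 0) (empty j)) (sum-replicate-zero n)

rowCount≡0⇒empty : (M : Matrix m n) → ∀ z → rowCount M z ≡ 0 → EmptyRow M z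
rowCount≡0⇒empty M z count≡0 j with M z j | term≤∑ (λ j → if M z j then 1 else 0) j
... | false | _     = refl
... | true  | 1≤sum = contradiction (subst (1 ≤_) count≡0 1≤sum) λ ()

ones-transpose : (M : Matrix m n) → ones (Tr M) ≡ ones M
ones-transpose M = trans (ones≡∑rowCount (Tr M))
  (trans (sym (∑-comm λ i j → if M i j then 1 else 0)) (sym (ones≡∑rowCount M)))

ones-deleteRow : (M : Matrix (suc m) n) → ∀ z → EmptyRow M z → ones (M ∘ punchIn z) ≡ ones M
ones-deleteRow M z empty = begin
  ones (M ∘ punchIn z)                ≡⟨ ones≡∑rowCount (M ∘ punchIn z) ⟩
  sum (rowCount M ∘ punchIn z)        ≡⟨ cong (_+ sum (rowCount M ∘ punchIn z)) (rowCount-empty M z empty) ⟨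
  rowCount M z + sum (rowCount M ∘ punchIn z) ≡⟨ sum-remove (rowCount M) ⟨
  sum (rowCount M)                    ≡⟨ ones≡∑rowCount M ⟨
  ones M                              ∎
  where open ≡-Reasoning

ones-duplicateRow : (M : Matrix m n) → ∀ z → EmptyRow M z → ones (M ∘ pinch z) ≡ ones M
ones-duplicateRow M z empty = begin
  ones (M ∘ pinch z)           ≡⟨ ones≡∑rowCount (M ∘ pinch z) ⟩
  sum (rowCount M ∘ pinch z)   ≡⟨ ∑-pinch (rowCount M) z ⟩
  rowCount M z + sum (rowCount M) ≡⟨ cong (_+ sum (rowCount M)) (rowCount-empty M z empty) ⟩
  sum (rowCount M)             ≡⟨ ones≡∑rowCount M ⟨
  ones M                       ∎
  where open ≡-Reasoning

emptyRow-exists : (M : Matrix m n) → ones M < m → ∃ (EmptyRow M)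
emptyRow-exists M ones<m =
  let z , count≡0 = ∑<n⇒zero (rowCount M) (subst (_< _) (ones≡∑rowCount M) ones<m)
  in z , rowCount≡0⇒empty M z count≡0

-- Reindexing rows

pinch-suc : (z : Fin m) → pinch z (Fin.suc z) ≡ z
pinch-suc {suc m} Fin.zero    = refl
pinch-suc {suc m} (Fin.suc z) = cong Fin.suc (pinch-suc z)

module _ {P : Matrix k l} (P-rows : EveryRowHasOne P) {M : Matrix m n}
         (f : Fin m' → Fin m) (f-mono : Monotonic₁ Fin._≤_ Fin._≤_ f)
         (f-injective : ∀ {i i'} j → M (f i) j ≡ true → f i ≡ f i' → i ≡ i')
         (f-onto : ∀ x j → M x j ≡ true → ∃ λ i → f i ≡ x) where

  Avoids-reindexRows : Avoids P M → Avoids P (M ∘ f)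
  Avoids-reindexRows avoids (R , C , R-inc , C-inc , hit) = avoids (f ∘ R , C , fR-inc , C-inc , hit)
    where
    fR-inc : StrictlyIncreasing (f ∘ R)
    fR-inc i i' i<i' = ≤∧≢⇒< (f-mono (<⇒≤ (R-inc i i' i<i'))) λ fRi≡fRi' →
      let j , Pij≡true = P-rows i
      in <⇒≢ (R-inc i i' i<i') (cong toℕ (f-injective (C j) (hit i j Pij≡true) (toℕ-injective fRi≡fRi')))

  Contains-setOne-reindexRows : ∀ i₀ j₀ → Contains P (setOne M (f i₀) j₀) →
    Contains P (setOne (M ∘ f) i₀ j₀)
  Contains-setOne-reindexRows i₀ j₀ (R , C , R-inc , C-inc , hit) = R′ , C , R′-inc , C-inc , hit′
    where
    preimage : ∀ x → Σ[ i ∈ Fin m' ] f i ≡ R x × (R x ≡ f i₀ → i ≡ i₀)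
    preimage x with P-rows x
    ... | c , Pxc≡true with setOne-true M (f i₀) j₀ (R x) (C c) (hit x c Pxc≡true)
    ...   | inj₁ (Rx≡fi₀ , _) = i₀ , sym Rx≡fi₀ , λ _ → refl
    ...   | inj₂ M≡true with f-onto (R x) (C c) M≡true
    ...     | i , fi≡Rx = i , fi≡Rx , λ Rx≡fi₀ →
                f-injective (C c) (subst (λ r → M r (C c) ≡ true) (sym fi≡Rx) M≡true) (trans fi≡Rx Rx≡fi₀)
    R′ : Fin k → Fin m'
    R′ = proj₁ ∘ preimage
    fR′≡R : ∀ x → f (R′ x) ≡ R x
    fR′≡R = proj₁ ∘ proj₂ ∘ preimage
    R′-inc : StrictlyIncreasing R′
    R′-inc = StrictlyIncreasing-cancelˡ f-mono fR′≡R R-inc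
    hit′ : ∀ x c → P x c ≡ true → setOne (M ∘ f) i₀ j₀ (R′ x) (C c) ≡ true
    hit′ x c Pxc≡true with setOne-true M (f i₀) j₀ (R x) (C c) (hit x c Pxc≡true)
    ... | inj₁ (Rx≡fi₀ , refl) rewrite proj₂ (proj₂ (preimage x)) Rx≡fi₀ = setOne-here (M ∘ f) i₀ (C c)
    ... | inj₂ M≡true = M⊆setOne (M ∘ f) i₀ j₀ (R′ x) (C c)
                          (subst (λ r → M r (C c) ≡ true) (sym (fR′≡R x)) M≡true)

  Saturating-reindexRows : Saturating P M → Saturating P (M ∘ f)
  Saturating-reindexRows (avoids , saturates) =
    Avoids-reindexRows avoids , λ i j Mfij≡false → Contains-setOne-reindexRows i j (saturates (f i) j Mfij≡false)

module _ {P : Matrix k l} (P-rows : EveryRowHasOne P) where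

  Saturating-deleteRow : {M : Matrix (suc m) n} → ∀ z → EmptyRow M z → Saturating P M →
    Saturating P (M ∘ punchIn z)
  Saturating-deleteRow {M = M} z empty = Saturating-reindexRows P-rows (punchIn z)
    (λ {i} {j} → Finₚ.punchIn-mono-≤ z i j) (λ _ _ → Finₚ.punchIn-injective z _ _) onto
    where
    onto : ∀ x j → M x j ≡ true → ∃ λ i → punchIn z i ≡ x
    onto x j Mxj≡true with z Fin.≟ x
    ... | yes refl = contradiction (trans (sym Mxj≡true) (empty j)) λ ()
    ... | no z≢x   = Fin.punchOut z≢x , Finₚ.punchIn-punchOut z≢x

  Saturating-duplicateRow : {M : Matrix m n} → ∀ z → EmptyRow M z → Saturating P M →
    Saturating P (M ∘ pinch z)
  Saturating-duplicateRow {M = M} z empty = Saturating-reindexRows P-rows (pinch z) (Finₚ.pinch-mono-≤ z)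
    injective (λ x _ _ → let i , pinch-i = Finₚ.pinch-surjective z x in i , pinch-i refl)
    where
    not-copy : ∀ {i} j → M (pinch z i) j ≡ true → Fin.suc z ≢ i
    not-copy j Mj≡true refl = contradiction
      (trans (sym Mj≡true) (subst (λ r → M r j ≡ false) (sym (pinch-suc z)) (empty j))) λ ()
    injective : ∀ {i i'} j → M (pinch z i) j ≡ true → pinch z i ≡ pinch z i' → i ≡ i'
    injective j Mj≡true eq = Finₚ.pinch-injective (not-copy j Mj≡true)
      (not-copy j (subst (λ r → M r j ≡ true) eq Mj≡true)) eq

  SatLe-deleteRows : ∀ {c} d → SatLe P (d + suc c) n c → SatLe P (suc c) n c
  SatLe-deleteRows zero    sat = sat
  SatLe-deleteRows {c = c} (suc d) (M , saturating , ones≤c) =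
    let z , empty = emptyRow-exists M (s≤s (≤-trans ones≤c (≤-trans (n≤1+n c) (m≤n+m (suc c) d))))
    in SatLe-deleteRows d (M ∘ punchIn z , Saturating-deleteRow z empty saturating ,
                           ≤-trans (≤-reflexive (ones-deleteRow M z empty)) ones≤c)

  SatLe-shrinkRows : ∀ {c} → c < m → SatLe P m n c → SatLe P (suc c) n c
  SatLe-shrinkRows {m} {n} {c} c<m = subst (λ m → SatLe P m n c → SatLe P (suc c) n c)
    (m∸n+n≡m c<m) (SatLe-deleteRows (m ∸ suc c))

  expandRows : ∀ t (M : Matrix m n) → Saturating P M → ∃ (EmptyRow M) →
    Σ[ f ∈ (Fin (t + m) → Fin m) ] Saturating P (M ∘ f) × ones (M ∘ f) ≡ ones M × ∃ (EmptyRow (M ∘ f))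
  expandRows zero    M saturating empty = id , saturating , refl , empty
  expandRows (suc t) M saturating empty with expandRows t M saturating empty
  ... | f , saturating′ , ones≡ , z , empty′ =
    f ∘ pinch z , Saturating-duplicateRow z empty′ saturating′ ,
    trans (ones-duplicateRow (M ∘ f) z empty′) ones≡ ,
    Fin.suc z , λ j → subst (λ r → M (f r) j ≡ false) (sym (pinch-suc z)) (empty′ j)

SatLe-transpose : {P : Matrix k l} {c : ℕ} → SatLe P m n c → SatLe (Tr P) n m c
SatLe-transpose (M , saturating , ones≤c) =
  Tr M , Saturating-transpose saturating , ≤-trans (≤-reflexive (ones-transpose M)) ones≤c

SatLe-emptyRow : {P : Matrix k l} {c : ℕ} → SatLe P m n c → c < m →
  Σ[ M ∈ Matrix m n ] Saturating P M × ∃ (EmptyRow M)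
SatLe-emptyRow (M , saturating , ones≤c) c<m = M , saturating , emptyRow-exists M (≤-<-trans ones≤c c<m)

SatLe-emptyCol : {P : Matrix k l} {c : ℕ} → SatLe P m n c → c < n →
  Σ[ M ∈ Matrix m n ] Saturating P M × ∃ (EmptyCol M)
SatLe-emptyCol sat c<n =
  let M , saturating , emptyCol = SatLe-emptyRow (SatLe-transpose sat) c<n
  in Tr M , Saturating-transpose saturating , emptyCol

module _ {P : Matrix k l} (P-rows : EveryRowHasOne P) (P-cols : EveryRowHasOne (Tr P)) where

  SatLe-expand : (M : Matrix m n) → Saturating P M → ∃ (EmptyRow M) → ∃ (EmptyCol M) →
    m ≤ m' → n ≤ n' → SatLe P m' n' (ones M)
  SatLe-expand {m} {n} {m'} {n'} M saturating emptyRow (z , emptyCol) m≤m' n≤n'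
    with expandRows P-rows (m' ∸ m) M saturating emptyRow
  ... | f , saturating′ , ones′ , _
    with expandRows P-cols (n' ∸ n) (Tr (M ∘ f)) (Saturating-transpose saturating′) (z , emptyCol ∘ f)
  ... | g , saturating″ , ones″ , _ =
    subst₂ (λ m' n' → SatLe P m' n' (ones M)) (m∸n+n≡m m≤m') (m∸n+n≡m n≤n') (SatLe-transpose
      (Tr (M ∘ f) ∘ g , saturating″ , ≤-reflexive (trans ones″ (trans (ones-transpose (M ∘ f)) ones′))))

  SatSquareO1-fromEmptyRowCol : (Σ[ M ∈ Matrix m n ] Saturating P M × ∃ (EmptyRow M) × ∃ (EmptyCol M)) →
    SatSquareO1 P
  SatSquareO1-fromEmptyRowCol {m} {n} (M , saturating , emptyRow , emptyCol) = ones M , m + n , λ n' m+n≤n' →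
    SatLe-expand M saturating emptyRow emptyCol (≤-trans (m≤m+n m n) m+n≤n') (≤-trans (m≤n+m n m) m+n≤n')

-- Saturating completions

anyFunction? : {Q : (Fin k → Fin m) → Set} → (∀ {f g} → f ≗ g → Q f → Q g) →
  (∀ f → Dec (Q f)) → Dec (∃ Q)
anyFunction? {zero} Q-resp Q? with Q? (λ ())
... | yes q = yes (_ , q)
... | no ¬q = no λ (f , q) → ¬q (Q-resp (λ ()) q)
anyFunction? {suc k} Q-resp Q?
  with any? (λ a → anyFunction? (λ f≗g → Q-resp (∷-cong refl f≗g)) (λ f → Q? (a Vector.∷ f)))
... | yes (a , f , q) = yes (_ , q)
... | no ¬q = no λ (f , q) → ¬q (f Fin.zero , f ∘ Fin.suc , Q-resp (∷-cong refl λ _ → refl) q)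

strictlyIncreasing? : (f : Fin k → Fin m) → Dec (StrictlyIncreasing f)
strictlyIncreasing? f = all? λ i → all? λ j → (toℕ i <? toℕ j) →-dec (toℕ (f i) <? toℕ (f j))

StrictlyIncreasing-resp : {f g : Fin k → Fin m} → f ≗ g → StrictlyIncreasing f → StrictlyIncreasing g
StrictlyIncreasing-resp f≗g f-inc i j i<j = subst₂ Fin._<_ (f≗g i) (f≗g j) (f-inc i j i<j)

contains? : (P : Matrix k l) (M : Matrix m n) → Dec (Contains P M)
contains? {k} {l} {m} {n} P M = anyFunction? R-resp λ R → anyFunction? (C-resp R) λ C →
  strictlyIncreasing? R ×-dec strictlyIncreasing? C ×-dec hits? R C
  where
  Hits : (Fin k → Fin m) → (Fin l → Fin n) → Set
  Hits R C = ∀ i j → P i j ≡ true → M (R i) (C j) ≡ true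
  Occurrence : (Fin k → Fin m) → (Fin l → Fin n) → Set
  Occurrence R C = StrictlyIncreasing R × StrictlyIncreasing C × Hits R C
  hits? : ∀ R C → Dec (Hits R C)
  hits? R C = all? λ i → all? λ j → (P i j Boolₚ.≟ true) →-dec (M (R i) (C j) Boolₚ.≟ true)
  C-resp : ∀ R {C C'} → C ≗ C' → Occurrence R C → Occurrence R C'
  C-resp R C≗C' (R-inc , C-inc , hit) =
    R-inc , StrictlyIncreasing-resp C≗C' C-inc ,
    λ i j p → subst (λ c → M (R i) c ≡ true) (C≗C' j) (hit i j p)
  R-resp : ∀ {R R'} → R ≗ R' → ∃ (Occurrence R) → ∃ (Occurrence R')
  R-resp R≗R' (C , R-inc , C-inc , hit) =
    C , StrictlyIncreasing-resp R≗R' R-inc , C-inc ,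
    λ i j p → subst (λ r → M r (C j) ≡ true) (R≗R' i) (hit i j p)

Blocked : Matrix k l → Matrix m n → Fin m × Fin n → Set
Blocked P M (i , j) = M i j ≡ true ⊎ Contains P (setOne M i j)

Blocked-⊆ : {P : Matrix k l} {M M' : Matrix m n} → M ⊆ M' → ∀ p → Blocked P M p → Blocked P M' p
Blocked-⊆ M⊆M' (i , j) (inj₁ Mij≡true) = inj₁ (M⊆M' i j Mij≡true)
Blocked-⊆ M⊆M' (i , j) (inj₂ occ)      = inj₂ (Contains-⊆ (setOne-⊆ i j M⊆M') occ)

⊆-trans : {M M' M″ : Matrix m n} → M ⊆ M' → M' ⊆ M″ → M ⊆ M″
⊆-trans M⊆M' M'⊆M″ i j = M'⊆M″ i j ∘ M⊆M' i j

module _ (P : Matrix k l) where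

  extendAlong : (L : List (Fin m × Fin n)) (M : Matrix m n) → Avoids P M →
    Σ[ M' ∈ Matrix m n ] M ⊆ M' × Avoids P M' × All (Blocked P M') L
  extendAlong []            M avoids = M , (λ _ _ → id) , avoids , []
  extendAlong ((i , j) ∷ L) M avoids with (M i j Boolₚ.≟ true) ⊎-dec contains? P (setOne M i j)
  ... | yes blocked =
    let M' , M⊆M' , avoids′ , allBlocked = extendAlong L M avoids
    in M' , M⊆M' , avoids′ , Blocked-⊆ M⊆M' (i , j) blocked ∷ allBlocked
  ... | no ¬blocked =
    let M' , M⊆M' , avoids′ , allBlocked = extendAlong L (setOne M i j) (¬blocked ∘ inj₂)
    in M' , ⊆-trans (M⊆setOne M i j) M⊆M' , avoids′ ,
       Blocked-⊆ M⊆M' (i , j) (inj₁ (setOne-here M i j)) ∷ allBlocked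

  saturate : (M : Matrix m n) → Avoids P M → Σ[ M' ∈ Matrix m n ] M ⊆ M' × Saturating P M'
  saturate {m} {n} M avoids with extendAlong (cartesianProduct (allFin m) (allFin n)) M avoids
  ... | M' , M⊆M' , avoids′ , allBlocked = M' , M⊆M' , avoids′ , saturates
    where
    saturates : ∀ i j → M' i j ≡ false → Contains P (setOne M' i j)
    saturates i j M'ij≡false with All.lookup allBlocked (∈-cartesianProduct⁺ (∈-allFin i) (∈-allFin j))
    ... | inj₁ M'ij≡true = contradiction (trans (sym M'ij≡true) M'ij≡false) λ ()
    ... | inj₂ occ       = occ

  Avoids-setOne⇒false : {M M' : Matrix m n} → M ⊆ M' → Avoids P M' → ∀ {i j} →
    Contains P (setOne M i j) → M' i j ≡ false
  Avoids-setOne⇒false {M = M} {M'} M⊆M' avoids {i} {j} occ = ¬-not λ M'ij≡true →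
    avoids (Contains-⊆ (⊆-trans (setOne-⊆ i j M⊆M') (setOne-⊆-self M' i j M'ij≡true)) occ)

-- Moving the last row or column of an occurrence

_[last≔_] : (Fin (suc k) → Fin m) → Fin m → Fin (suc k) → Fin m
_[last≔_] {k} f x i with i Fin.≟ fromℕ k
... | yes _ = x
... | no _  = f i

[last≔]-other : (f : Fin (suc k) → Fin m) (x : Fin m) → ∀ {i} → i ≢ fromℕ k → (f [last≔ x ]) i ≡ f i
[last≔]-other {k} f x {i} i≢last with i Fin.≟ fromℕ k
... | yes i≡last = contradiction i≡last i≢last
... | no _       = refl

[last≔]-increasing : {f : Fin (suc k) → Fin m} {x : Fin m} → StrictlyIncreasing f →
  (∀ i → f i Fin.< x) → StrictlyIncreasing (f [last≔ x ])
[last≔]-increasing {k} {f = f} {x} f-inc f<x i j i<j with j Fin.≟ fromℕ k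
... | yes refl = subst (Fin._< x) (sym ([last≔]-other f x i≢last)) (f<x i)
  where
  i≢last : i ≢ fromℕ k
  i≢last refl = <-irrefl refl i<j
... | no _ = subst (Fin._< f j) (sym ([last≔]-other f x i≢last)) (f-inc i j i<j)
  where
  i≢last : i ≢ fromℕ k
  i≢last refl = <⇒≱ i<j (Finₚ.≤fromℕ j)

module LastRowOccurrence {P : Matrix (suc k) l} (lastRow : OneInRow P (fromℕ k))
         {A : Matrix (suc m) n} (avoids : Avoids P A)
         {y R C} (R-inc : StrictlyIncreasing R) (C-inc : StrictlyIncreasing C)
         (hit : ∀ i j → P i j ≡ true → setOne A (fromℕ m) y (R i) (C j) ≡ true) where

  hit-notLast : ∀ {i} j → i ≢ fromℕ k → P i j ≡ true → A (R i) (C j) ≡ true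
  hit-notLast {i} j i≢last Pij≡true with setOne-true A (fromℕ m) y (R i) (C j) (hit i j Pij≡true)
  ... | inj₁ (Ri≡last , _) = contradiction Ri≡last (StrictlyIncreasing-≢fromℕ R-inc i≢last)
  ... | inj₂ A≡true        = A≡true

  hit-last : C (proj₁ lastRow) ≡ y
  hit-last with C (proj₁ lastRow) Fin.≟ y
  ... | yes Cβ≡y = Cβ≡y
  ... | no Cβ≢y  = contradiction (R , C , R-inc , C-inc , hitA) avoids
    where
    hitA : ∀ i j → P i j ≡ true → A (R i) (C j) ≡ true
    hitA i j Pij≡true with i Fin.≟ fromℕ k
    ... | no i≢last = hit-notLast j i≢last Pij≡true
    ... | yes refl
      with proj₂ (proj₂ lastRow) j Pij≡true | setOne-true A (fromℕ m) y (R i) (C j) (hit i j Pij≡true)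
    ...   | refl | inj₁ (_ , Cβ≡y) = contradiction Cβ≡y Cβ≢y
    ...   | refl | inj₂ A≡true     = A≡true

-- Only the last row of P can use the new 1, and its single 1 can be moved to any lower row.
Contains-setOne-lowerRow : {P : Matrix (suc k) l} → OneInRow P (fromℕ k) →
  {A : Matrix (suc m) n} {M : Matrix m' n'} (S : Submatrix A M) → Avoids P A →
  ∀ y → Contains P (setOne A (fromℕ m) y) →
  ∀ x' → (∀ x → Submatrix.row S x Fin.< x') → Contains P (setOne M x' (Submatrix.col S y))
Contains-setOne-lowerRow {P = P} lastRow {A} {M} S avoids y (R , C , R-inc , C-inc , hit) x' above =
  (row ∘ R) [last≔ x' ] , col ∘ C ,
  [last≔]-increasing (StrictlyIncreasing-∘ row-inc R-inc) (above ∘ R) , StrictlyIncreasing-∘ col-inc C-inc ,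
  hit′
  where
  open Submatrix S
  open LastRowOccurrence lastRow {A = A} avoids R-inc C-inc hit
  hit′ : ∀ i j → P i j ≡ true → setOne M x' (col y) (((row ∘ R) [last≔ x' ]) i) (col (C j)) ≡ true
  hit′ i j Pij≡true with i Fin.≟ fromℕ _
  ... | yes refl rewrite proj₂ (proj₂ lastRow) j Pij≡true | hit-last = setOne-here M x' (col y)
  ... | no i≢last = M⊆setOne M x' (col y) (row (R i)) (col (C j))
    (trans (entry (R i) (C j)) (hit-notLast j i≢last Pij≡true))

Contains-setOne-rightCol : {P : Matrix k (suc l)} → OneInCol P (fromℕ l) →
  {A : Matrix m (suc n)} {M : Matrix m' n'} (S : Submatrix A M) → Avoids P A →
  ∀ x → Contains P (setOne A x (fromℕ n)) →
  ∀ y' → (∀ y → Submatrix.col S y Fin.< y') → Contains P (setOne M (Submatrix.row S x) y')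
Contains-setOne-rightCol {n = n} {P = P} lastCol {A} {M} S avoids x occ y' left =
  Contains-⊆ (setOne-transpose (Tr M) y' (Submatrix.row S x))
    (Contains-transpose {P = Tr P} {M = setOne (Tr M) y' (Submatrix.row S x)}
      (Contains-setOne-lowerRow lastCol (Submatrix-transpose S)
        (λ occ′ → avoids (Contains-transpose {P = Tr P} {M = Tr A} occ′)) x
        (Contains-⊆ (setOne-transpose A x (fromℕ n)) (Contains-transpose {P = P} {M = setOne A x (fromℕ n)} occ))
        y' left))

-- The antidiagonal block matrix

initialSegment : {Q : Fin n → Set} → (∀ x → Dec (Q x)) → (∀ {x y} → x Fin.≤ y → Q y → Q x) →
  ∃ λ t → ∀ x → Q x ⇔ toℕ x < t
initialSegment {zero} Q? down = 0 , λ ()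
initialSegment {suc n} Q? down with Q? Fin.zero
... | no ¬Q₀ = 0 , λ x → mk⇔ (λ Qx → contradiction (down z≤n Qx) ¬Q₀) λ ()
... | yes Q₀ with initialSegment (Q? ∘ Fin.suc) (λ x≤y → down (s≤s x≤y))
...   | t , segment = suc t , λ
  { Fin.zero    → mk⇔ (λ _ → s≤s z≤n) (λ _ → Q₀)
  ; (Fin.suc x) → mk⇔ (s≤s ∘ Equivalence.to (segment x)) (Equivalence.from (segment x) ∘ s≤s⁻¹) }

↑ˡ-increasing : ∀ h → StrictlyIncreasing (λ (x : Fin m) → x ↑ˡ h)
↑ˡ-increasing h x y x<y = subst₂ _<_ (sym (Finₚ.toℕ-↑ˡ x h)) (sym (Finₚ.toℕ-↑ˡ y h)) x<y

↑ʳ-increasing : ∀ a → StrictlyIncreasing (λ (x : Fin m) → a ↑ʳ x)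
↑ʳ-increasing a x y x<y = subst₂ _<_ (sym (Finₚ.toℕ-↑ʳ a x)) (sym (Finₚ.toℕ-↑ʳ a y)) (+-monoʳ-< a x<y)

↑ˡ<↑ʳ : ∀ {a h} (x : Fin a) (y : Fin h) → x ↑ˡ h Fin.< a ↑ʳ y
↑ˡ<↑ʳ {a} {h} x y = subst₂ _<_ (sym (Finₚ.toℕ-↑ˡ x h)) (sym (Finₚ.toℕ-↑ʳ a y))
  (<-≤-trans (Finₚ.toℕ<n x) (m≤m+n a _))

↑ˡ-preimage : ∀ {a h} (i : Fin (a + h)) → toℕ i < a → ∃ λ x → x ↑ˡ h ≡ i
↑ˡ-preimage {a} i i<a = _ , Finₚ.splitAt⁻¹-↑ˡ (Finₚ.splitAt-< a i i<a)

↑ʳ-preimage : ∀ {a h} (i : Fin (a + h)) → a ≤ toℕ i → ∃ λ x → a ↑ʳ x ≡ i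
↑ʳ-preimage {a} i a≤i = _ , Finₚ.splitAt⁻¹-↑ʳ (Finₚ.splitAt-≥ a i a≤i)

splitAt-inj₁⇒< : ∀ a {h} {i : Fin (a + h)} {x} → splitAt a i ≡ inj₁ x → toℕ i < a
splitAt-inj₁⇒< a {h} {x = x} eq =
  subst (λ i → toℕ i < a) (Finₚ.splitAt⁻¹-↑ˡ eq)
    (subst (_< a) (sym (Finₚ.toℕ-↑ˡ x h)) (Finₚ.toℕ<n x))

splitAt-inj₂⇒≥ : ∀ a {h} {i : Fin (a + h)} {y} → splitAt a i ≡ inj₂ y → a ≤ toℕ i
splitAt-inj₂⇒≥ a {y = y} eq =
  subst (λ i → a ≤ toℕ i) (Finₚ.splitAt⁻¹-↑ʳ eq)
    (subst (a ≤_) (sym (Finₚ.toℕ-↑ʳ a y)) (m≤m+n a _))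

↑ˡ⊎↑ʳ : ∀ a {h} (i : Fin (a + h)) → (∃ λ x → x ↑ˡ h ≡ i) ⊎ (∃ λ y → a ↑ʳ y ≡ i)
↑ˡ⊎↑ʳ a i with splitAt a i in eq
... | inj₁ x = inj₁ (x , Finₚ.splitAt⁻¹-↑ˡ eq)
... | inj₂ y = inj₂ (y , Finₚ.splitAt⁻¹-↑ʳ eq)

module Antidiagonal {a w h b} (A : Matrix a w) (B : Matrix h b) where

  block : Fin a ⊎ Fin h → Fin b ⊎ Fin w → Bool
  block (inj₁ x) (inj₂ y) = A x y
  block (inj₂ x) (inj₁ y) = B x y
  block (inj₁ _) (inj₁ _) = false
  block (inj₂ _) (inj₂ _) = false

  K : Matrix (a + h) (b + w)
  K i j = block (splitAt a i) (splitAt b j)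

  K-support : ∀ i j → K i j ≡ true → (toℕ i < a × b ≤ toℕ j) ⊎ (a ≤ toℕ i × toℕ j < b)
  K-support i j = support refl refl
    where
    support : ∀ {si sj} → splitAt a i ≡ si → splitAt b j ≡ sj → block si sj ≡ true →
      (toℕ i < a × b ≤ toℕ j) ⊎ (a ≤ toℕ i × toℕ j < b)
    support {inj₁ _} {inj₂ _} si sj _ = inj₁ (splitAt-inj₁⇒< a si , splitAt-inj₂⇒≥ b sj)
    support {inj₂ _} {inj₁ _} si sj _ = inj₂ (splitAt-inj₂⇒≥ a si , splitAt-inj₁⇒< b sj)

  A-submatrix : Submatrix A K
  A-submatrix = record
    { row = _↑ˡ h ; col = b ↑ʳ_ ; row-inc = ↑ˡ-increasing h ; col-inc = ↑ʳ-increasing b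
    ; entry = λ x y → cong₂ block (Finₚ.splitAt-↑ˡ a x h) (Finₚ.splitAt-↑ʳ b w y) }

  B-submatrix : Submatrix B K
  B-submatrix = record
    { row = a ↑ʳ_ ; col = _↑ˡ w ; row-inc = ↑ʳ-increasing a ; col-inc = ↑ˡ-increasing w
    ; entry = λ x y → cong₂ block (Finₚ.splitAt-↑ʳ a h x) (Finₚ.splitAt-↑ˡ b y w) }

  module _ {P : Matrix k l} (P-rows : EveryRowHasOne P) (P-cols : EveryRowHasOne (Tr P))
           {R : Fin k → Fin (a + h)} {C : Fin l → Fin (b + w)}
           (R-inc : StrictlyIncreasing R) (C-inc : StrictlyIncreasing C)
           (hit : ∀ i j → P i j ≡ true → K (R i) (C j) ≡ true) where

    occurrence-in-A : (∀ i j → P i j ≡ true → toℕ (R i) < a) → Contains P A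
    occurrence-in-A inA = Contains-restrict A-submatrix R C R-inc C-inc hit
      (λ i → let j , Pij≡true = P-rows i in ↑ˡ-preimage (R i) (inA i j Pij≡true))
      (λ j → let i , Pij≡true = P-cols j in ↑ʳ-preimage (C j) (right i j Pij≡true))
      where
      right : ∀ i j → P i j ≡ true → b ≤ toℕ (C j)
      right i j Pij≡true with K-support (R i) (C j) (hit i j Pij≡true)
      ... | inj₁ (_ , b≤Cj) = b≤Cj
      ... | inj₂ (a≤Ri , _) = contradiction (inA i j Pij≡true) (≤⇒≯ a≤Ri)

    occurrence-in-B : (∀ i j → P i j ≡ true → a ≤ toℕ (R i)) → Contains P B
    occurrence-in-B inB = Contains-restrict B-submatrix R C R-inc C-inc hit
      (λ i → let j , Pij≡true = P-rows i in ↑ʳ-preimage (R i) (inB i j Pij≡true))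
      (λ j → let i , Pij≡true = P-cols j in ↑ˡ-preimage (C j) (left i j Pij≡true))
      where
      left : ∀ i j → P i j ≡ true → toℕ (C j) < b
      left i j Pij≡true with K-support (R i) (C j) (hit i j Pij≡true)
      ... | inj₁ (Ri<a , _) = contradiction Ri<a (≤⇒≯ (inB i j Pij≡true))
      ... | inj₂ (_ , Cj<b) = Cj<b

    occurrence-antiDiagForm : (∃ λ i → ∃ λ j → P i j ≡ true × toℕ (R i) < a) →
      (∃ λ i → ∃ λ j → P i j ≡ true × a ≤ toℕ (R i)) →
      ∃ λ r₀ → ∃ λ c₀ → AntiDiagForm P r₀ c₀
    occurrence-antiDiagForm (i₁ , j₁ , p₁ , Ri₁<a) (i₂ , j₂ , p₂ , a≤Ri₂) =
      r₀ , c₀ , quadrant , topRight , bottomLeft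
      where
      rowSplit = initialSegment (λ i → toℕ (R i) <? a)
        (λ x≤y Ry<a → ≤-<-trans (StrictlyIncreasing⇒monotone R-inc x≤y) Ry<a)
      colSplit = initialSegment (λ j → toℕ (C j) <? b)
        (λ x≤y Cy<b → ≤-<-trans (StrictlyIncreasing⇒monotone C-inc x≤y) Cy<b)
      r₀ = proj₁ rowSplit
      c₀ = proj₁ colSplit
      top : ∀ i → toℕ (R i) < a ⇔ toℕ i < r₀
      top = proj₂ rowSplit
      left : ∀ j → toℕ (C j) < b ⇔ toℕ j < c₀
      left = proj₂ colSplit
      quadrant : ∀ i j → P i j ≡ true → (toℕ i < r₀ × c₀ ≤ toℕ j) ⊎ (r₀ ≤ toℕ i × toℕ j < c₀)
      quadrant i j Pij≡true with K-support (R i) (C j) (hit i j Pij≡true)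
      ... | inj₁ (Ri<a , b≤Cj) = inj₁ (Equivalence.to (top i) Ri<a ,
                                       ≮⇒≥ λ j<c₀ → ≤⇒≯ b≤Cj (Equivalence.from (left j) j<c₀))
      ... | inj₂ (a≤Ri , Cj<b) = inj₂ (≮⇒≥ (λ i<r₀ → ≤⇒≯ a≤Ri (Equivalence.from (top i) i<r₀)) ,
                                       Equivalence.to (left j) Cj<b)
      topRight : ∃ λ i → ∃ λ j → P i j ≡ true × toℕ i < r₀ × c₀ ≤ toℕ j
      topRight with quadrant i₁ j₁ p₁
      ... | inj₁ q           = i₁ , j₁ , p₁ , q
      ... | inj₂ (r₀≤i₁ , _) = contradiction (Equivalence.to (top i₁) Ri₁<a) (≤⇒≯ r₀≤i₁)
      bottomLeft : ∃ λ i → ∃ λ j → P i j ≡ true × r₀ ≤ toℕ i × toℕ j < c₀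
      bottomLeft with quadrant i₂ j₂ p₂
      ... | inj₁ (i₂<r₀ , _) = contradiction (Equivalence.from (top i₂) i₂<r₀) (≤⇒≯ a≤Ri₂)
      ... | inj₂ q           = i₂ , j₂ , p₂ , q

  Avoids-antidiagonal : {P : Matrix k l} → Indecomposable P →
    EveryRowHasOne P → EveryRowHasOne (Tr P) →
    Avoids P A → Avoids P B → Avoids P K
  Avoids-antidiagonal {P = P} indecomposable P-rows P-cols avoidsA avoidsB (R , C , R-inc , C-inc , hit)
    with any? (λ i → any? λ j → (P i j Boolₚ.≟ true) ×-dec (toℕ (R i) <? a))
       | any? (λ i → any? λ j → (P i j Boolₚ.≟ true) ×-dec (a ≤? toℕ (R i)))
  ... | yes inA | yes inB = indecomposable
    (let r₀ , c₀ , form = occurrence-antiDiagForm P-rows P-cols R-inc C-inc hit inA inB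
     in r₀ , c₀ , inj₂ form)
  ... | _       | no ¬inB = avoidsA (occurrence-in-A P-rows P-cols R-inc C-inc hit
                                      λ i j p → ≰⇒> λ a≤Ri → ¬inB (i , j , p , a≤Ri))
  ... | no ¬inA | yes _   = avoidsB (occurrence-in-B P-rows P-cols R-inc C-inc hit
                                      λ i j p → ≮⇒≥ λ Ri<a → ¬inA (i , j , p , Ri<a))

saturated-antidiagonal : {P : Matrix (suc k) (suc l)} → Indecomposable P →
  EveryRowHasOne P → EveryRowHasOne (Tr P) → OneInRow P (fromℕ k) → OneInCol P (fromℕ l) →
  ∀ {a w h b} {A : Matrix (suc a) w} {B : Matrix h (suc b)} →
  Saturating P A → Saturating P B → ∃ (EmptyCol A) → ∃ (EmptyRow B) →
  Σ[ M ∈ Matrix (suc a + h) (suc b + w) ] Saturating P M × ∃ (EmptyRow M) × ∃ (EmptyCol M)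
saturated-antidiagonal {P = P} indecomposable P-rows P-cols lastRow lastCol {a} {w} {h} {b} {A} {B}
  (avoidsA , saturatesA) (avoidsB , saturatesB) (e , emptyA) (r , emptyB) =
  M , saturating , (suc a ↑ʳ r , Avoids-setOne⇒false P K⊆M (proj₁ saturating) ∘ blockedRow) ,
                   (suc b ↑ʳ e , Avoids-setOne⇒false P K⊆M (proj₁ saturating) ∘ blockedCol)
  where
  open Antidiagonal A B
  completion : Σ[ M ∈ Matrix (suc a + h) (suc b + w) ] K ⊆ M × Saturating P M
  completion = saturate P K (Avoids-antidiagonal indecomposable P-rows P-cols avoidsA avoidsB)
  M = proj₁ completion
  K⊆M = proj₁ (proj₂ completion)
  saturating = proj₂ (proj₂ completion)
  blockedRow : ∀ j → Contains P (setOne K (suc a ↑ʳ r) j)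
  blockedRow j with ↑ˡ⊎↑ʳ (suc b) j
  ... | inj₁ (y , refl) = Contains-submatrix (Submatrix-setOne B-submatrix r y) (saturatesB r y (emptyB y))
  ... | inj₂ (y , refl) = Contains-setOne-rightCol lastCol B-submatrix avoidsB r
                            (saturatesB r (fromℕ b) (emptyB (fromℕ b))) (suc b ↑ʳ y) (λ y' → ↑ˡ<↑ʳ y' y)
  blockedCol : ∀ i → Contains P (setOne K i (suc b ↑ʳ e))
  blockedCol i with ↑ˡ⊎↑ʳ (suc a) i
  ... | inj₁ (x , refl) = Contains-submatrix (Submatrix-setOne A-submatrix x e) (saturatesA x e (emptyA x))
  ... | inj₂ (x , refl) = Contains-setOne-lowerRow lastRow A-submatrix avoidsA e
                            (saturatesA (fromℕ a) e (emptyA (fromℕ a))) (suc a ↑ʳ x) (λ x' → ↑ˡ<↑ʳ x' x)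

SatSquareO1⇒SatRowsColsO1 : {P : Matrix k l} →
  EveryRowHasOne P → EveryRowHasOne (Tr P) →
  SatSquareO1 P → ∃ λ m₀ → ∃ λ n₀ → SatRowsO1 P (suc m₀) × SatColsO1 P (suc n₀)
SatSquareO1⇒SatRowsColsO1 P-rows P-cols (c , N , sat≤c) =
  c , c , (c , N + suc c , λ n N+c<n → SatLe-shrinkRows P-rows (c<n N+c<n) (sat≤c n (N≤n N+c<n))) ,
          (c , N + suc c , λ m N+c<m →
             SatLe-transpose (SatLe-shrinkRows P-cols (c<n N+c<m) (SatLe-transpose (sat≤c m (N≤n N+c<m)))))
  where
  c<n : ∀ {n} → N + suc c ≤ n → c < n
  c<n = ≤-trans (m≤n+m (suc c) N)
  N≤n : ∀ {n} → N + suc c ≤ n → N ≤ n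
  N≤n = ≤-trans (m≤m+n N (suc c))

SatRowsColsO1⇒SatSquareO1 : {P : Matrix (suc k) (suc l)} → Indecomposable P →
  EveryRowHasOne P → EveryRowHasOne (Tr P) →
  OneInRow P (fromℕ k) → OneInCol P (fromℕ l) →
  (∃ λ m₀ → ∃ λ n₀ → SatRowsO1 P (suc m₀) × SatColsO1 P (suc n₀)) → SatSquareO1 P
SatRowsColsO1⇒SatSquareO1 {P = P} indecomposable P-rows P-cols lastRow lastCol
  (m₀ , n₀ , (c₁ , N₁ , rows≤c₁) , (c₂ , N₂ , cols≤c₂)) =
  glue (SatLe-emptyCol (rows≤c₁ (N₁ + suc c₁) (m≤m+n N₁ _)) (m≤n+m (suc c₁) N₁))
       (SatLe-emptyRow (cols≤c₂ (N₂ + suc c₂) (m≤m+n N₂ _)) (m≤n+m (suc c₂) N₂))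
  where
  glue : ∀ {w h} → Σ[ A ∈ Matrix (suc m₀) w ] Saturating P A × ∃ (EmptyCol A) →
    Σ[ B ∈ Matrix h (suc n₀) ] Saturating P B × ∃ (EmptyRow B) → SatSquareO1 P
  glue (_ , saturatingA , emptyColA) (_ , saturatingB , emptyRowB) =
    SatSquareO1-fromEmptyRowCol P-rows P-cols (saturated-antidiagonal indecomposable P-rows P-cols
      lastRow lastCol saturatingA saturatingB emptyColA emptyRowB)

lemma1p6 : ∀ {k l} (P : Matrix (suc k) (suc l)) →
    Indecomposable P → NoEmptyRowsCols P →
    OneInRow P (fromℕ k) → OneInCol P (fromℕ l) →
    SatSquareO1 P ⇔ (∃ λ m₀ → ∃ λ n₀ → SatRowsO1 P (suc m₀) × SatColsO1 P (suc n₀))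
lemma1p6 P indecomposable (noEmptyRow , noEmptyCol) lastRow lastCol = mk⇔
  (SatSquareO1⇒SatRowsColsO1 P-rows P-cols)
  (SatRowsColsO1⇒SatSquareO1 indecomposable P-rows P-cols lastRow lastCol)
  where
  P-rows = ¬EmptyRow⇒hasOne P noEmptyRow
  P-cols = ¬EmptyRow⇒hasOne (Tr P) noEmptyCol
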